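{- Let $G\mathcal{L}$ be the Gentzen relation axiomatized by the calculus $G\mathcal{B}$ extended by a set of generalized cut rules. Then $G\mathcal{L}$ enjoys $(G\mathcal{L},G\mathcal{B})$-interpolation: whenever a sequent $t$ is derivable from a sequent $s$ in $G\mathcal{L}$, there is a sequent $u$ such that $u$ is derivable from $s$ in $G\mathcal{L}$, $t$ is derivable from $u$ in $G\mathcal{B}$, and every atom occurring in $u$ occurs in both $s$ and $t$.
   Context: Formulas are built from atoms using $\wedge,\vee,{ - },\top,\bot$; a sequent $\Gamma\vartriangleright\Delta$ is a pair of finite multisets of formulas; atomic if all its formulas are atoms. The calculus $G\mathcal{B}$ consists of: introduction rules (from $\Gamma\vartriangleright\Delta,\varphi$ and $\Gamma\vartriangleright\Delta,\psi$ infer $\Gamma\vartriangleright\Delta,\varphi\wedge\psi$; from $\varphi,\psi,\Gamma\vartriangleright\Delta$ infer $\varphi\wedge\psi,\Gamma\vartriangleright\Delta$; from $\varphi,\Gamma\vartriangleright\Delta$ and $\psi,\Gamma\vartriangleright\Delta$ infer $\varphi\vee\psi,\Gamma\vartriangleright\Delta$; from $\Gamma\vartriangleright\Delta,\varphi,\psi$ infer $\Gamma\vartriangleright\Delta,\varphi\vee\psi$; from $\varphi,\Gamma\vartriangleright\Delta$ infer $\Gamma\vartriangleright\Delta,{ - }\varphi$; from $\Gamma\vartriangleright\Delta,\varphi$ infer ${ - }\varphi,\Gamma\vartriangleright\Delta$; axioms $\emptyset\vartriangleright\top$, $\bot\vartriangleright\emptyset$); elimination rules (from $\Gamma\vartriangleright\Delta,\varphi\wedge\psi$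 infer $\Gamma\vartriangleright\Delta,\varphi$, and infer $\Gamma\vartriangleright\Delta,\psi$; from $\varphi\wedge\psi,\Gamma\vartriangleright\Delta$ infer $\varphi,\psi,\Gamma\vartriangleright\Delta$; from $\varphi\vee\psi,\Gamma\vartriangleright\Delta$ infer $\varphi,\Gamma\vartriangleright\Delta$, and infer $\psi,\Gamma\vartriangleright\Delta$; from $\Gamma\vartriangleright\Delta,\varphi\vee\psi$ infer $\Gamma\vartriangleright\Delta,\varphi,\psi$; from $\Gamma\vartriangleright\Delta,{ - }\varphi$ infer $\varphi,\Gamma\vartriangleright\Delta$; from ${ - }\varphi,\Gamma\vartriangleright\Delta$ infer $\Gamma\vartriangleright\Delta,\varphi$; from $\top,\Gamma\vartriangleright\Delta$ infer $\Gamma\vartriangleright\Delta$; from $\Gamma\vartriangleright\Delta,\bot$ infer $\Gamma\vartriangleright\Delta$); Weakening and Contraction on both sides. $G\mathcal{B}$ also denotes the derivability relation of this calculus. A structural rule is a rule (possibly infinitary) whose premises and conclusion are atomic sequents, applied in all substitution instances. An atom is a cut formula of a structural rule if it occurs only in the premises of the rule; it is a side formula if it occurs only on left-hand sides, or only on right-hand sides, of the sequents of the rule. A generalized cut rule is a structural rule in which every atom occurring in it is a cut formula or a side formula. The Gentzen relation axiomatized by a calculus is the relation "$t$ is derivable from the set $S$ in the calculus" (proofs being well-founded labelled trees). -}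

module Defs where

open import Data.Nat using (ℕ)
open import Data.List using (List; []; _∷_; map)
open import Data.List.Membership.Propositional using (_∈_)
open import Data.List.Relation.Unary.All using (All)
open import Data.List.Relation.Binary.Permutation.Propositional using (_↭_)
open import Data.Product using (Σ; _×_; ∃)
open import Data.Sum using (_⊎_)
open import Data.Empty using (⊥)
open import Relation.Nullary using (¬_)
open import Relation.Binary.PropositionalEquality using (_≡_)

Atom : Set
Atom = ℕ

data Fm : Set where
  at   : Atom → Fm
  _∧′_ : Fm → Fm → Fm
  _∨′_ : Fm → Fm → Fm
  -′_  : Fm → Fm
  ⊤′   : Fm
  ⊥′   : Fm

infixr 6 _∧′_
infixr 5 _∨′_

-- Sequents: pairs of finite multisets, represented as lists; the
-- derivation relation below is closed under permutation of each side,
-- so lists are taken up to permutation (= multisets).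
record Seq : Set where
  constructor _▷_
  field
    lhs : List Fm
    rhs : List Fm
open Seq public

infix 4 _▷_

data OccFm (p : Atom) : Fm → Set where
  o-at  : OccFm p (at p)
  o-∧l  : ∀ {φ ψ} → OccFm p φ → OccFm p (φ ∧′ ψ)
  o-∧r  : ∀ {φ ψ} → OccFm p ψ → OccFm p (φ ∧′ ψ)
  o-∨l  : ∀ {φ ψ} → OccFm p φ → OccFm p (φ ∨′ ψ)
  o-∨r  : ∀ {φ ψ} → OccFm p ψ → OccFm p (φ ∨′ ψ)
  o-neg : ∀ {φ} → OccFm p φ → OccFm p (-′ φ)

OccList : Atom → List Fm → Set
OccList p Γ = Σ Fm (λ φ → φ ∈ Γ × OccFm p φ)

OccSeq : Atom → Seq → Set
OccSeq p s = OccList p (lhs s) ⊎ OccList p (rhs s)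

IsAtom : Fm → Set
IsAtom φ = ∃ λ p → φ ≡ at p

AtomicSeq : Seq → Set
AtomicSeq s = All IsAtom (lhs s) × All IsAtom (rhs s)

subFm : (Atom → Fm) → Fm → Fm
subFm σ (at p)    = σ p
subFm σ (φ ∧′ ψ)  = subFm σ φ ∧′ subFm σ ψ
subFm σ (φ ∨′ ψ)  = subFm σ φ ∨′ subFm σ ψ
subFm σ (-′ φ)    = -′ subFm σ φ
subFm σ ⊤′        = ⊤′
subFm σ ⊥′        = ⊥′

subSeq : (Atom → Fm) → Seq → Seq
subSeq σ (Γ ▷ Δ) = map (subFm σ) Γ ▷ map (subFm σ) Δ

-- A structural rule: a (possibly infinite) family of atomic premises
-- and an atomic conclusion; applied in all substitution instances.
record StructRule : Set₁ where
  field
    Prem        : Set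
    prem        : Prem → Seq
    concl       : Seq
    premAtomic  : (i : Prem) → AtomicSeq (prem i)
    conclAtomic : AtomicSeq concl
open StructRule public

OccRule : Atom → StructRule → Set
OccRule p r = OccSeq p (concl r) ⊎ Σ (Prem r) (λ i → OccSeq p (prem r i))

IsCutFormula : Atom → StructRule → Set
IsCutFormula p r = ¬ OccSeq p (concl r)

OnlyLeft : Atom → StructRule → Set
OnlyLeft p r = ¬ OccList p (rhs (concl r)) × ((i : Prem r) → ¬ OccList p (rhs (prem r i)))

OnlyRight : Atom → StructRule → Set
OnlyRight p r = ¬ OccList p (lhs (concl r)) × ((i : Prem r) → ¬ OccList p (lhs (prem r i)))

IsSideFormula : Atom → StructRule → Set
IsSideFormula p r = OnlyLeft p r ⊎ OnlyRight p r

IsGenCut : StructRule → Set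
IsGenCut r = (p : Atom) → OccRule p r → IsCutFormula p r ⊎ IsSideFormula p r

record RuleSet : Set₁ where
  field
    Idx  : Set
    rule : Idx → StructRule
open RuleSet public

noRules : RuleSet
noRules = record { Idx = ⊥ ; rule = λ () }

-- Derivability of t from a set S of sequents in G𝓑 extended by the rules E
-- (well-founded, possibly infinitely branching derivation trees).
data Der (E : RuleSet) (S : Seq → Set) : Seq → Set₁ where
  hyp   : ∀ {s} → S s → Der E S s
  perm  : ∀ {Γ Γ′ Δ Δ′} → Γ ↭ Γ′ → Δ ↭ Δ′ → Der E S (Γ ▷ Δ) → Der E S (Γ′ ▷ Δ′)
  ∧R    : ∀ {Γ Δ φ ψ} → Der E S (Γ ▷ φ ∷ Δ) → Der E S (Γ ▷ ψ ∷ Δ) → Der E S (Γ ▷ (φ ∧′ ψ) ∷ Δ)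
  ∧L    : ∀ {Γ Δ φ ψ} → Der E S (φ ∷ ψ ∷ Γ ▷ Δ) → Der E S ((φ ∧′ ψ) ∷ Γ ▷ Δ)
  ∨L    : ∀ {Γ Δ φ ψ} → Der E S (φ ∷ Γ ▷ Δ) → Der E S (ψ ∷ Γ ▷ Δ) → Der E S ((φ ∨′ ψ) ∷ Γ ▷ Δ)
  ∨R    : ∀ {Γ Δ φ ψ} → Der E S (Γ ▷ φ ∷ ψ ∷ Δ) → Der E S (Γ ▷ (φ ∨′ ψ) ∷ Δ)
  -R    : ∀ {Γ Δ φ} → Der E S (φ ∷ Γ ▷ Δ) → Der E S (Γ ▷ (-′ φ) ∷ Δ)
  -L    : ∀ {Γ Δ φ} → Der E S (Γ ▷ φ ∷ Δ) → Der E S ((-′ φ) ∷ Γ ▷ Δ)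
  ⊤ax   : Der E S ([] ▷ ⊤′ ∷ [])
  ⊥ax   : Der E S (⊥′ ∷ [] ▷ [])
  ∧R-e₁ : ∀ {Γ Δ φ ψ} → Der E S (Γ ▷ (φ ∧′ ψ) ∷ Δ) → Der E S (Γ ▷ φ ∷ Δ)
  ∧R-e₂ : ∀ {Γ Δ φ ψ} → Der E S (Γ ▷ (φ ∧′ ψ) ∷ Δ) → Der E S (Γ ▷ ψ ∷ Δ)
  ∧L-e  : ∀ {Γ Δ φ ψ} → Der E S ((φ ∧′ ψ) ∷ Γ ▷ Δ) → Der E S (φ ∷ ψ ∷ Γ ▷ Δ)
  ∨L-e₁ : ∀ {Γ Δ φ ψ} → Der E S ((φ ∨′ ψ) ∷ Γ ▷ Δ) → Der E S (φ ∷ Γ ▷ Δ)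
  ∨L-e₂ : ∀ {Γ Δ φ ψ} → Der E S ((φ ∨′ ψ) ∷ Γ ▷ Δ) → Der E S (ψ ∷ Γ ▷ Δ)
  ∨R-e  : ∀ {Γ Δ φ ψ} → Der E S (Γ ▷ (φ ∨′ ψ) ∷ Δ) → Der E S (Γ ▷ φ ∷ ψ ∷ Δ)
  -R-e  : ∀ {Γ Δ φ} → Der E S (Γ ▷ (-′ φ) ∷ Δ) → Der E S (φ ∷ Γ ▷ Δ)
  -L-e  : ∀ {Γ Δ φ} → Der E S ((-′ φ) ∷ Γ ▷ Δ) → Der E S (Γ ▷ φ ∷ Δ)
  ⊤L-e  : ∀ {Γ Δ} → Der E S (⊤′ ∷ Γ ▷ Δ) → Der E S (Γ ▷ Δ)
  ⊥R-e  : ∀ {Γ Δ} → Der E S (Γ ▷ ⊥′ ∷ Δ) → Der E S (Γ ▷ Δ)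
  wL    : ∀ {Γ Δ φ} → Der E S (Γ ▷ Δ) → Der E S (φ ∷ Γ ▷ Δ)
  wR    : ∀ {Γ Δ φ} → Der E S (Γ ▷ Δ) → Der E S (Γ ▷ φ ∷ Δ)
  cL    : ∀ {Γ Δ φ} → Der E S (φ ∷ φ ∷ Γ ▷ Δ) → Der E S (φ ∷ Γ ▷ Δ)
  cR    : ∀ {Γ Δ φ} → Der E S (Γ ▷ φ ∷ φ ∷ Δ) → Der E S (Γ ▷ φ ∷ Δ)
  str   : (k : Idx E) (σ : Atom → Fm) →
          ((i : Prem (rule E k)) → Der E S (subSeq σ (prem (rule E k) i))) →
          Der E S (subSeq σ (concl (rule E k)))

_⊢[_]_ : Seq → RuleSet → Seq → Set₁
s ⊢[ E ] t = Der E (λ x → x ≡ s) t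

-- In the four-valued semantics of Belnap and Dunn, G𝓑 (which has no identity axiom) is
-- complete in a local form: a sequent is derivable once every valuation refuting it
-- refutes some derivable atomic sequent.  By induction on a G𝓛-derivation of t from s,
-- every valuation refuting t refutes an atomic sequent over the atoms of s that is
-- G𝓛-derivable from s.  At a generalized cut rule the atoms of the conclusion are side
-- formulas; erasing from their substituted formulas the atoms foreign to s (to ⊤ or ⊥ by
-- side and polarity) keeps the conclusion refuted, while a refutation of a modified
-- premise becomes one of the original premise by making the foreign atoms both true and
-- false.  Probing t with the valuations of the atomic sequents of its conjunctive normal
-- form gives finitely many such sequents, each contained in one of those; their
-- conjunction is the interpolant.
module Submission where

open import Defs
open import Level using (0ℓ)
open import Data.Nat using (_≟_)
open import Data.Empty using (⊥; ⊥-elim)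
open import Data.Unit using (⊤; tt)
open import Data.Product as Product using (Σ; _×_; _,_; proj₁; proj₂)
open import Data.Sum as Sum using (_⊎_; inj₁; inj₂; [_,_])
open import Data.List using (List; []; _∷_; map; _++_; cartesianProductWith)
open import Data.List.Properties using (++-identityʳ)
open import Data.List.Relation.Unary.Any using (Any; here; there; any?)
open import Data.List.Relation.Unary.Any.Properties as Any using (mapWith∈⁺)
open import Data.List.Relation.Unary.All as All using (All; []; _∷_)
open import Data.List.Relation.Unary.All.Properties as All using (++⁺; ++⁻; map⁺)
open import Data.List.Membership.Propositional using (_∈_; find; lose; mapWith∈)
open import Data.List.Membership.Propositional.Properties using (∈-∃++; ∈-++⁺ˡ; ∈-map⁺; ∈-map⁻)
open import Data.List.Relation.Binary.Permutation.Propositional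
  using (_↭_; ↭-refl; ↭-sym; ↭-reflexive; prep; swap)
open import Data.List.Relation.Binary.Permutation.Propositional.Properties
  using (shift; shifts; ++-comm; All-resp-↭)
open import Relation.Nullary using (¬_; Dec; yes; no)
open import Relation.Nullary.Decidable using (map′; _⊎-dec_)
open import Relation.Unary using (Pred; _∪_; _∩_; ∁; _⊆_)
open import Relation.Binary.PropositionalEquality as ≡ using (_≡_; refl; sym; cong)

AtomSet : Set₁
AtomSet = Pred Atom 0ℓ

atoms : List Atom → List Fm
atoms = map at

atoms-++ : ∀ L₂ L₁ (Γ : List Fm) → atoms L₂ ++ atoms L₁ ++ Γ ≡ atoms (L₂ ++ L₁) ++ Γ
atoms-++ []       L₁ Γ = refl
atoms-++ (l ∷ L₂) L₁ Γ = cong (at l ∷_) (atoms-++ L₂ L₁ Γ)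

All-mapWith∈ : ∀ {ℓ} {X Y : Set} {P : Y → Set ℓ} (xs : List X) (f : ∀ {x} → x ∈ xs → Y) →
               (∀ {x} (x∈ : x ∈ xs) → P (f x∈)) → All P (mapWith∈ xs f)
All-mapWith∈ []       f h = []
All-mapWith∈ (x ∷ xs) f h = h (here refl) ∷ All-mapWith∈ xs (λ m → f (there m)) (λ m → h (there m))

Var : Fm → AtomSet
Var φ p = OccFm p φ

Vars : List Fm → AtomSet
Vars Γ p = OccList p Γ

SeqVars : Seq → AtomSet
SeqVars t p = OccSeq p t

Var? : ∀ φ p → Dec (Var φ p)
Var? (at q)   p = map′ (λ { refl → o-at }) (λ { o-at → refl }) (p ≟ q)
Var? (φ ∧′ ψ) p = map′ [ o-∧l , o-∧r ] (λ { (o-∧l o) → inj₁ o ; (o-∧r o) → inj₂ o })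
                         (Var? φ p ⊎-dec Var? ψ p)
Var? (φ ∨′ ψ) p = map′ [ o-∨l , o-∨r ] (λ { (o-∨l o) → inj₁ o ; (o-∨r o) → inj₂ o })
                         (Var? φ p ⊎-dec Var? ψ p)
Var? (-′ φ)   p = map′ o-neg (λ { (o-neg o) → o }) (Var? φ p)
Var? ⊤′       p = no (λ ())
Var? ⊥′       p = no (λ ())

Vars? : ∀ Γ p → Dec (Vars Γ p)
Vars? Γ p = map′ find (λ (φ , φ∈Γ , o) → lose φ∈Γ o) (any? (λ φ → Var? φ p) Γ)

SeqVars? : ∀ t p → Dec (SeqVars t p)
SeqVars? t p = Vars? (lhs t) p ⊎-dec Vars? (rhs t) p

Var⊆Vars : ∀ {φ Γ} → φ ∈ Γ → Var φ ⊆ Vars Γ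
Var⊆Vars {φ} φ∈Γ o = φ , φ∈Γ , o

Vars-∷ : ∀ {γ Γ} → Vars Γ ⊆ Vars (γ ∷ Γ)
Vars-∷ (φ , φ∈Γ , o) = φ , there φ∈Γ , o

Clause : Set
Clause = List Atom × List Atom

clauseSeq : Clause → Seq
clauseSeq (L , R) = atoms L ▷ atoms R

AllAtoms : AtomSet → AtomSet → Clause → Set
AllAtoms A B (L , R) = All A L × All B R

AllAtoms-mono : ∀ {A B A′ B′ : AtomSet} → A ⊆ A′ → B ⊆ B′ →
                ∀ {c} → AllAtoms A B c → AllAtoms A′ B′ c
AllAtoms-mono f g (a , b) = All.map f a , All.map g b

Within : AtomSet → Clause → Set
Within P = AllAtoms P P

Within-mono : ∀ {P Q} → P ⊆ Q → ∀ {c} → Within P c → Within Q c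
Within-mono f = AllAtoms-mono f f

All-Within-mono : ∀ {P Q} → P ⊆ Q → ∀ {cs} → All (Within P) cs → All (Within Q) cs
All-Within-mono f = All.map (Within-mono f)

Within-∩ : ∀ {P Q c} → Within P c → Within Q c → Within (P ∩ Q) c
Within-∩ (pl , pr) (ql , qr) = All.zip (pl , ql) , All.zip (pr , qr)

_⊆ᶜ_ : Clause → Clause → Set
d ⊆ᶜ (L , R) = AllAtoms (_∈ L) (_∈ R) d

⊆ᶜ-refl : ∀ c → c ⊆ᶜ c
⊆ᶜ-refl (L , R) = All.tabulate (λ m → m) , All.tabulate (λ m → m)

AllAtoms-⊆ᶜ : ∀ {A B : AtomSet} {c d} → d ⊆ᶜ c → AllAtoms A B c → AllAtoms A B d
AllAtoms-⊆ᶜ (l , r) (a , b) = All.map (All.lookup a) l , All.map (All.lookup b) r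

_⊕_ : Clause → Clause → Clause
(L₁ , R₁) ⊕ (L₂ , R₂) = L₁ ++ L₂ , R₁ ++ R₂

AllAtoms-⊕⁺ : ∀ {A B : AtomSet} c d → AllAtoms A B c → AllAtoms A B d → AllAtoms A B (c ⊕ d)
AllAtoms-⊕⁺ _ _ (a , b) (a′ , b′) = ++⁺ a a′ , ++⁺ b b′

AllAtoms-⊕⁻ : ∀ {A B : AtomSet} c d → AllAtoms A B (c ⊕ d) → AllAtoms A B c × AllAtoms A B d
AllAtoms-⊕⁻ (L₁ , R₁) _ (a , b) =
  (proj₁ (++⁻ L₁ a) , proj₁ (++⁻ R₁ b)) , (proj₂ (++⁻ L₁ a) , proj₂ (++⁻ R₁ b))

-- (A , B) is a four-valued valuation in the sense of Belnap and Dunn: A holds the atoms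
-- that are true, B those that are false, and the two need be neither disjoint nor exhaustive.
Holds Fails : AtomSet → AtomSet → Fm → Set
Holds A B (at p)   = A p
Holds A B (φ ∧′ ψ) = Holds A B φ × Holds A B ψ
Holds A B (φ ∨′ ψ) = Holds A B φ ⊎ Holds A B ψ
Holds A B (-′ φ)   = Fails A B φ
Holds A B ⊤′       = ⊤
Holds A B ⊥′       = ⊥
Fails A B (at p)   = B p
Fails A B (φ ∧′ ψ) = Fails A B φ ⊎ Fails A B ψ
Fails A B (φ ∨′ ψ) = Fails A B φ × Fails A B ψ
Fails A B (-′ φ)   = Holds A B φ
Fails A B ⊤′       = ⊥
Fails A B ⊥′       = ⊤

Refutes : AtomSet → AtomSet → Seq → Set
Refutes A B t = All (Holds A B) (lhs t) × All (Fails A B) (rhs t)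

Refutes-resp-↭ : ∀ {A B Γ Γ′ Δ Δ′} → Γ ↭ Γ′ → Δ ↭ Δ′ →
                 Refutes A B (Γ ▷ Δ) → Refutes A B (Γ′ ▷ Δ′)
Refutes-resp-↭ p q (l , r) = All-resp-↭ p l , All-resp-↭ q r

refutes-clauseSeq : ∀ {A B} c → AllAtoms A B c → Refutes A B (clauseSeq c)
refutes-clauseSeq _ (a , b) = map⁺ a , map⁺ b

Holds-mono : ∀ {A B A′ B′} → A ⊆ A′ → B ⊆ B′ → ∀ φ → Holds A B φ → Holds A′ B′ φ
Fails-mono : ∀ {A B A′ B′} → A ⊆ A′ → B ⊆ B′ → ∀ φ → Fails A B φ → Fails A′ B′ φ
Holds-mono f g (at p)   a         = f a
Holds-mono f g (φ ∧′ ψ) (a , b)   = Holds-mono f g φ a , Holds-mono f g ψ b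
Holds-mono f g (φ ∨′ ψ) (inj₁ a)  = inj₁ (Holds-mono f g φ a)
Holds-mono f g (φ ∨′ ψ) (inj₂ b)  = inj₂ (Holds-mono f g ψ b)
Holds-mono f g (-′ φ)   a         = Fails-mono f g φ a
Holds-mono f g ⊤′       a         = a
Holds-mono f g ⊥′       a         = a
Fails-mono f g (at p)   b         = g b
Fails-mono f g (φ ∧′ ψ) (inj₁ a)  = inj₁ (Fails-mono f g φ a)
Fails-mono f g (φ ∧′ ψ) (inj₂ b)  = inj₂ (Fails-mono f g ψ b)
Fails-mono f g (φ ∨′ ψ) (a , b)   = Fails-mono f g φ a , Fails-mono f g ψ b
Fails-mono f g (-′ φ)   a         = Holds-mono f g φ a
Fails-mono f g ⊤′       a         = a
Fails-mono f g ⊥′       a         = a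

module Structural (E : RuleSet) (S : Seq → Set) where

  D : Seq → Set₁
  D = Der E S

  permL : ∀ {Γ Γ′ Δ} → Γ ↭ Γ′ → D (Γ ▷ Δ) → D (Γ′ ▷ Δ)
  permL p = perm p ↭-refl

  permR : ∀ {Γ Δ Δ′} → Δ ↭ Δ′ → D (Γ ▷ Δ) → D (Γ ▷ Δ′)
  permR = perm ↭-refl

  dropNilʳ : ∀ {Γ Δ} → D (Γ ++ [] ▷ Δ ++ []) → D (Γ ▷ Δ)
  dropNilʳ {Γ} {Δ} = perm (↭-reflexive (++-identityʳ Γ)) (↭-reflexive (++-identityʳ Δ))

  addNilʳ : ∀ {Γ Δ} → D (Γ ▷ Δ) → D (Γ ++ [] ▷ Δ ++ [])
  addNilʳ {Γ} {Δ} = perm (↭-reflexive (sym (++-identityʳ Γ))) (↭-reflexive (sym (++-identityʳ Δ)))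

  weakenL* : ∀ Z {Γ Δ} → D (Γ ▷ Δ) → D (Z ++ Γ ▷ Δ)
  weakenL* []      d = d
  weakenL* (_ ∷ Z) d = wL (weakenL* Z d)

  weakenR* : ∀ Z {Γ Δ} → D (Γ ▷ Δ) → D (Γ ▷ Z ++ Δ)
  weakenR* []      d = d
  weakenR* (_ ∷ Z) d = wR (weakenR* Z d)

  absorbL : ∀ {x Γ Δ} → x ∈ Γ → D (x ∷ Γ ▷ Δ) → D (Γ ▷ Δ)
  absorbL {x} x∈Γ d with ys , zs , refl ← ∈-∃++ x∈Γ =
    permL (↭-sym (shift x ys zs)) (cL (permL (prep x (shift x ys zs)) d))

  absorbR : ∀ {x Γ Δ} → x ∈ Δ → D (Γ ▷ x ∷ Δ) → D (Γ ▷ Δ)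
  absorbR {x} x∈Δ d with ys , zs , refl ← ∈-∃++ x∈Δ =
    permR (↭-sym (shift x ys zs)) (cR (permR (prep x (shift x ys zs)) d))

  enlargeL : ∀ L′ L {Γ Δ} → All (_∈ L) L′ → D (atoms L′ ++ Γ ▷ Δ) → D (atoms L ++ Γ ▷ Δ)
  enlargeL []       L _ d = weakenL* (atoms L) d
  enlargeL (x ∷ L′) L {Γ} (x∈L ∷ sub) d =
    absorbL (∈-++⁺ˡ (∈-map⁺ at x∈L))
      (permL (shift (at x) (atoms L) Γ)
        (enlargeL L′ L sub (permL (↭-sym (shift (at x) (atoms L′) Γ)) d)))

  enlargeR : ∀ R′ R {Γ Δ} → All (_∈ R) R′ → D (Γ ▷ atoms R′ ++ Δ) → D (Γ ▷ atoms R ++ Δ)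
  enlargeR []       R _ d = weakenR* (atoms R) d
  enlargeR (x ∷ R′) R {Δ = Δ} (x∈R ∷ sub) d =
    absorbR (∈-++⁺ˡ (∈-map⁺ at x∈R))
      (permR (shift (at x) (atoms R) Δ)
        (enlargeR R′ R sub (permR (↭-sym (shift (at x) (atoms R′) Δ)) d)))

  weaken-⊆ᶜ : ∀ {d c} → d ⊆ᶜ c → D (clauseSeq d) → D (clauseSeq c)
  weaken-⊆ᶜ {L′ , R′} {L , R} (l , r) d =
    dropNilʳ (enlargeL L′ L l (enlargeR R′ R r (addNilʳ d)))

  ⊥L : ∀ {Γ Δ} → D (⊥′ ∷ Γ ▷ Δ)
  ⊥L {Γ} {Δ} =
    perm (++-comm Γ (⊥′ ∷ [])) (↭-reflexive (++-identityʳ Δ)) (weakenL* Γ (weakenR* Δ ⊥ax))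

  ⊤R : ∀ {Γ Δ} → D (Γ ▷ ⊤′ ∷ Δ)
  ⊤R {Γ} {Δ} =
    perm (↭-reflexive (++-identityʳ Γ)) (++-comm Δ (⊤′ ∷ [])) (weakenL* Γ (weakenR* Δ ⊤ax))

module Completeness (E : RuleSet) (S : Seq → Set) where
  open Structural E S

  Covered : Seq → Set₁
  Covered t = ∀ A B → Refutes A B t → Σ Clause λ d → AllAtoms A B d × D (clauseSeq d)

  covered-anti : ∀ {t t′} → (∀ {A B} → Refutes A B t′ → Refutes A B t) → Covered t → Covered t′
  covered-anti f o A B x = o A B (f x)

  covered-↭ : ∀ {Γ Γ′ Δ Δ′} → Γ ↭ Γ′ → Δ ↭ Δ′ →
              Covered (Γ ▷ Δ) → Covered (Γ′ ▷ Δ′)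
  covered-↭ p q = covered-anti (Refutes-resp-↭ (↭-sym p) (↭-sym q))

  -- Passed as a continuation, so that decomposing φ ∧′ ψ on the left
  -- (φ ∨′ ψ on the right) recurses structurally on ψ as well.
  Complete : List Fm → List Fm → Set₁
  Complete Γ Δ = ∀ L R → Covered (atoms L ++ Γ ▷ atoms R ++ Δ) → D (atoms L ++ Γ ▷ atoms R ++ Δ)

  complete-atoms : Complete [] []
  complete-atoms L R o
    with d , d⊆c , ⊢d ← covered-↭ (↭-reflexive (++-identityʳ (atoms L)))
                                   (↭-reflexive (++-identityʳ (atoms R))) o
                                   (_∈ L) (_∈ R) (refutes-clauseSeq (L , R) (⊆ᶜ-refl (L , R)))
    = addNilʳ (weaken-⊆ᶜ d⊆c ⊢d)

  complete-extend : ∀ {Γ Δ} L₁ R₁ → Complete Γ Δ → Complete (atoms L₁ ++ Γ) (atoms R₁ ++ Δ)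
  complete-extend {Γ} {Δ} L₁ R₁ k L₂ R₂ o =
    perm (↭-reflexive (sym (atoms-++ L₂ L₁ Γ))) (↭-reflexive (sym (atoms-++ R₂ R₁ Δ)))
      (k (L₂ ++ L₁) (R₂ ++ R₁)
        (covered-↭ (↭-reflexive (atoms-++ L₂ L₁ Γ)) (↭-reflexive (atoms-++ R₂ R₁ Δ)) o))

  completeL : ∀ φ {Γ Δ} → Complete Γ Δ → Covered (φ ∷ Γ ▷ Δ) → D (φ ∷ Γ ▷ Δ)
  completeR : ∀ φ {Γ Δ} → Complete Γ Δ → Covered (Γ ▷ φ ∷ Δ) → D (Γ ▷ φ ∷ Δ)
  complete-∷ˡ : ∀ φ {Γ Δ} → Complete Γ Δ → Complete (φ ∷ Γ) Δ
  complete-∷ʳ : ∀ φ {Γ Δ} → Complete Γ Δ → Complete Γ (φ ∷ Δ)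

  completeL (at p)   k o = k (p ∷ []) [] o
  completeL (φ ∧′ ψ) k o =
    ∧L (completeL φ (complete-∷ˡ ψ k) (covered-anti (λ { (a ∷ b ∷ l , r) → (a , b) ∷ l , r }) o))
  completeL (φ ∨′ ψ) k o =
    ∨L (completeL φ k (covered-anti (λ { (a ∷ l , r) → inj₁ a ∷ l , r }) o))
       (completeL ψ k (covered-anti (λ { (b ∷ l , r) → inj₂ b ∷ l , r }) o))
  completeL (-′ φ)   k o = -L (completeR φ k (covered-anti (λ { (l , a ∷ r) → a ∷ l , r }) o))
  completeL ⊤′       k o = wL (k [] [] (covered-anti (λ { (l , r) → tt ∷ l , r }) o))
  completeL ⊥′       k o = ⊥L

  completeR (at p)   k o = k [] (p ∷ []) o
  completeR (φ ∧′ ψ) k o =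
    ∧R (completeR φ k (covered-anti (λ { (l , a ∷ r) → l , inj₁ a ∷ r }) o))
       (completeR ψ k (covered-anti (λ { (l , b ∷ r) → l , inj₂ b ∷ r }) o))
  completeR (φ ∨′ ψ) k o =
    ∨R (completeR φ (complete-∷ʳ ψ k) (covered-anti (λ { (l , a ∷ b ∷ r) → l , (a , b) ∷ r }) o))
  completeR (-′ φ)   k o = -R (completeL φ k (covered-anti (λ { (a ∷ l , r) → l , a ∷ r }) o))
  completeR ⊤′       k o = ⊤R
  completeR ⊥′       k o = wR (k [] [] (covered-anti (λ { (l , r) → l , tt ∷ r }) o))

  complete-∷ˡ φ {Γ} k L R o =
    permL (↭-sym (shift φ (atoms L) Γ))
      (completeL φ (complete-extend L R k) (covered-↭ (shift φ (atoms L) Γ) ↭-refl o))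
  complete-∷ʳ φ {Δ = Δ} k L R o =
    permR (↭-sym (shift φ (atoms R) Δ))
      (completeR φ (complete-extend L R k) (covered-↭ ↭-refl (shift φ (atoms R) Δ) o))

  complete-++ˡ : ∀ Γ {Z Δ} → Complete Z Δ → Complete (Γ ++ Z) Δ
  complete-++ˡ []      k = k
  complete-++ˡ (γ ∷ Γ) k = complete-∷ˡ γ (complete-++ˡ Γ k)

  complete-++ʳ : ∀ Δ {Γ Z} → Complete Γ Z → Complete Γ (Δ ++ Z)
  complete-++ʳ []      k = k
  complete-++ʳ (δ ∷ Δ) k = complete-∷ʳ δ (complete-++ʳ Δ k)

  covered⇒derivable : ∀ {t} → Covered t → D t
  covered⇒derivable {Γ ▷ Δ} o =
    dropNilʳ (complete-++ˡ Γ (complete-++ʳ Δ complete-atoms) [] []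
      (covered-↭ (↭-reflexive (sym (++-identityʳ Γ))) (↭-reflexive (sym (++-identityʳ Δ))) o))

module Inversion (E : RuleSet) (S : Seq → Set) {A B : AtomSet} where
  open Structural E S

  -- The atomic sequent that the elimination rules leave of refuted formulas of a
  -- derivable sequent, Γ ▷ Δ being the part not yet decomposed.
  record Residue (P : AtomSet) (Γ Δ : List Fm) : Set₁ where
    constructor residue
    field
      left right : List Atom
      refuted    : AllAtoms A B (left , right)
      within     : Within P (left , right)
      derivable  : D (atoms left ++ Γ ▷ atoms right ++ Δ)
  open Residue public

  residue-mono : ∀ {P Q Γ Δ} → P ⊆ Q → Residue P Γ Δ → Residue Q Γ Δ
  residue-mono f (residue L R ab p d) = residue L R ab (Within-mono f p) d

  stack : ∀ {P Q U Γ Δ Γ′ Δ′} → P ⊆ U → Q ⊆ U → (x : Residue P Γ′ Δ′) →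
          Residue Q (atoms (left x) ++ Γ) (atoms (right x) ++ Δ) → Residue U Γ Δ
  stack {Γ = Γ} {Δ} f g (residue L₁ R₁ ab₁ p₁ _) (residue L₂ R₂ ab₂ p₂ d₂) =
    residue (L₂ ++ L₁) (R₂ ++ R₁)
      (AllAtoms-⊕⁺ (L₂ , R₂) (L₁ , R₁) ab₂ ab₁)
      (AllAtoms-⊕⁺ (L₂ , R₂) (L₁ , R₁) (Within-mono g p₂) (Within-mono f p₁))
      (perm (↭-reflexive (atoms-++ L₂ L₁ Γ)) (↭-reflexive (atoms-++ R₂ R₁ Δ)) d₂)

  nothing-left : ∀ {P Γ Δ} → D (Γ ▷ Δ) → Residue P Γ Δ
  nothing-left = residue [] [] ([] , []) ([] , [])

  residueL : ∀ φ {Γ Δ} → Holds A B φ → D (φ ∷ Γ ▷ Δ) → Residue (Var φ) Γ Δ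
  residueR : ∀ φ {Γ Δ} → Fails A B φ → D (Γ ▷ φ ∷ Δ) → Residue (Var φ) Γ Δ
  residueL (at p)   a        d = residue (p ∷ []) [] (a ∷ [] , []) (o-at ∷ [] , []) d
  residueL (φ ∧′ ψ) {Γ} (a , b) d =
    let x = residueL φ a (∧L-e d)
    in stack o-∧l o-∧r x (residueL ψ b (permL (shift ψ (atoms (left x)) Γ) (derivable x)))
  residueL (φ ∨′ ψ) (inj₁ a) d = residue-mono o-∨l (residueL φ a (∨L-e₁ d))
  residueL (φ ∨′ ψ) (inj₂ b) d = residue-mono o-∨r (residueL ψ b (∨L-e₂ d))
  residueL (-′ φ)   a        d = residue-mono o-neg (residueR φ a (-L-e d))
  residueL ⊤′       _        d = nothing-left (⊤L-e d)
  residueR (at p)   b        d = residue [] (p ∷ []) ([] , b ∷ []) ([] , o-at ∷ []) d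
  residueR (φ ∧′ ψ) (inj₁ a) d = residue-mono o-∧l (residueR φ a (∧R-e₁ d))
  residueR (φ ∧′ ψ) (inj₂ b) d = residue-mono o-∧r (residueR ψ b (∧R-e₂ d))
  residueR (φ ∨′ ψ) {Δ = Δ} (a , b) d =
    let x = residueR φ a (∨R-e d)
    in stack o-∨l o-∨r x (residueR ψ b (permR (shift ψ (atoms (right x)) Δ) (derivable x)))
  residueR (-′ φ)   a        d = residue-mono o-neg (residueL φ a (-R-e d))
  residueR ⊥′       _        d = nothing-left (⊥R-e d)

  residueΓ : ∀ Γ {Z Δ} → All (Holds A B) Γ → D (Γ ++ Z ▷ Δ) → Residue (Vars Γ) Z Δ
  residueΓ []      _        d = nothing-left d
  residueΓ (γ ∷ Γ) (a ∷ as) d =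
    let x = residueL γ a d
    in stack (Var⊆Vars (here refl)) Vars-∷ x
         (residueΓ Γ as (permL (shifts (atoms (left x)) Γ) (derivable x)))

  residueΔ : ∀ Δ {Γ Z} → All (Fails A B) Δ → D (Γ ▷ Δ ++ Z) → Residue (Vars Δ) Γ Z
  residueΔ []      _        d = nothing-left d
  residueΔ (δ ∷ Δ) (b ∷ bs) d =
    let x = residueR δ b d
    in stack (Var⊆Vars (here refl)) Vars-∷ x
         (residueΔ Δ bs (permR (shifts (atoms (right x)) Δ) (derivable x)))

  residueSeq : ∀ {t} → D t → Refutes A B t → Residue (SeqVars t) [] []
  residueSeq {Γ ▷ Δ} d (as , bs) =
    let x = residueΓ Γ as (addNilʳ d)
    in stack inj₁ inj₂ x (residueΔ Δ bs (permR (shifts (atoms (right x)) Δ) (derivable x)))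

module Erasure (I : AtomSet) (I? : ∀ p → Dec (I p)) where

  keep : Fm → (p : Atom) → Dec (I p) → Fm
  keep c p (yes _) = at p
  keep c p (no _)  = c

  keep-intro : ∀ {X : Fm → Set} c p d → X (at p) → X c → X (keep c p d)
  keep-intro c p (yes _) x _ = x
  keep-intro c p (no _)  _ y = y

  keep-elim : ∀ {X : Fm → Set} {Y : Set} c p d →
              (I p → X (at p) → Y) → (¬ I p → X c → Y) → X (keep c p d) → Y
  keep-elim c p (yes i)  f _ x = f i x
  keep-elim c p (no ¬i)  _ g x = g ¬i x

  eraseL eraseR : Fm → Fm
  eraseL (at p)   = keep ⊤′ p (I? p)
  eraseL (φ ∧′ ψ) = eraseL φ ∧′ eraseL ψ
  eraseL (φ ∨′ ψ) = eraseL φ ∨′ eraseL ψ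
  eraseL (-′ φ)   = -′ eraseR φ
  eraseL ⊤′       = ⊤′
  eraseL ⊥′       = ⊥′
  eraseR (at p)   = keep ⊥′ p (I? p)
  eraseR (φ ∧′ ψ) = eraseR φ ∧′ eraseR ψ
  eraseR (φ ∨′ ψ) = eraseR φ ∨′ eraseR ψ
  eraseR (-′ φ)   = -′ eraseL φ
  eraseR ⊤′       = ⊤′
  eraseR ⊥′       = ⊥′

  module _ {A B : AtomSet} where

    Holds-eraseL : ∀ φ → Holds A B φ → Holds A B (eraseL φ)
    Fails-eraseR : ∀ φ → Fails A B φ → Fails A B (eraseR φ)
    Holds-eraseL (at p)   a        = keep-intro {X = Holds A B} ⊤′ p (I? p) a tt
    Holds-eraseL (φ ∧′ ψ) (a , b)  = Holds-eraseL φ a , Holds-eraseL ψ b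
    Holds-eraseL (φ ∨′ ψ) (inj₁ a) = inj₁ (Holds-eraseL φ a)
    Holds-eraseL (φ ∨′ ψ) (inj₂ b) = inj₂ (Holds-eraseL ψ b)
    Holds-eraseL (-′ φ)   a        = Fails-eraseR φ a
    Holds-eraseL ⊤′       a        = a
    Fails-eraseR (at p)   b        = keep-intro {X = Fails A B} ⊥′ p (I? p) b tt
    Fails-eraseR (φ ∧′ ψ) (inj₁ a) = inj₁ (Fails-eraseR φ a)
    Fails-eraseR (φ ∧′ ψ) (inj₂ b) = inj₂ (Fails-eraseR ψ b)
    Fails-eraseR (φ ∨′ ψ) (a , b)  = Fails-eraseR φ a , Fails-eraseR ψ b
    Fails-eraseR (-′ φ)   a        = Holds-eraseL φ a
    Fails-eraseR ⊥′       b        = b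

    eraseL-Holds : ∀ φ → Holds A B (eraseL φ) → Holds (A ∪ ∁ I) (B ∪ ∁ I) φ
    eraseR-Fails : ∀ φ → Fails A B (eraseR φ) → Fails (A ∪ ∁ I) (B ∪ ∁ I) φ
    eraseL-Holds (at p)   = keep-elim {X = Holds A B} ⊤′ p (I? p) (λ _ → inj₁) (λ ¬i _ → inj₂ ¬i)
    eraseL-Holds (φ ∧′ ψ) (a , b)  = eraseL-Holds φ a , eraseL-Holds ψ b
    eraseL-Holds (φ ∨′ ψ) (inj₁ a) = inj₁ (eraseL-Holds φ a)
    eraseL-Holds (φ ∨′ ψ) (inj₂ b) = inj₂ (eraseL-Holds ψ b)
    eraseL-Holds (-′ φ)   a        = eraseR-Fails φ a
    eraseL-Holds ⊤′       a        = a
    eraseR-Fails (at p)   = keep-elim {X = Fails A B} ⊥′ p (I? p) (λ _ → inj₁) (λ ¬i _ → inj₂ ¬i)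
    eraseR-Fails (φ ∧′ ψ) (inj₁ a) = inj₁ (eraseR-Fails φ a)
    eraseR-Fails (φ ∧′ ψ) (inj₂ b) = inj₂ (eraseR-Fails ψ b)
    eraseR-Fails (φ ∨′ ψ) (a , b)  = eraseR-Fails φ a , eraseR-Fails ψ b
    eraseR-Fails (-′ φ)   a        = eraseL-Holds φ a
    eraseR-Fails ⊥′       b        = b

  Var-eraseL : ∀ φ → Var (eraseL φ) ⊆ I
  Var-eraseR : ∀ φ → Var (eraseR φ) ⊆ I
  Var-eraseL (at p) {q} = keep-elim {X = OccFm q} ⊤′ p (I? p) (λ { i o-at → i }) (λ _ ())
  Var-eraseL (φ ∧′ ψ) (o-∧l o) = Var-eraseL φ o
  Var-eraseL (φ ∧′ ψ) (o-∧r o) = Var-eraseL ψ o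
  Var-eraseL (φ ∨′ ψ) (o-∨l o) = Var-eraseL φ o
  Var-eraseL (φ ∨′ ψ) (o-∨r o) = Var-eraseL ψ o
  Var-eraseL (-′ φ)   (o-neg o) = Var-eraseR φ o
  Var-eraseR (at p) {q} = keep-elim {X = OccFm q} ⊥′ p (I? p) (λ { i o-at → i }) (λ _ ())
  Var-eraseR (φ ∧′ ψ) (o-∧l o) = Var-eraseR φ o
  Var-eraseR (φ ∧′ ψ) (o-∧r o) = Var-eraseR ψ o
  Var-eraseR (φ ∨′ ψ) (o-∨l o) = Var-eraseR φ o
  Var-eraseR (φ ∨′ ψ) (o-∨r o) = Var-eraseR ψ o
  Var-eraseR (-′ φ)   (o-neg o) = Var-eraseL φ o

All-subst-atomic : ∀ {τ₁ τ₂ : Atom → Fm} {F G : Fm → Set} Γ → All IsAtom Γ →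
                   (∀ {p} → at p ∈ Γ → F (τ₁ p) → G (τ₂ p)) →
                   All F (map (subFm τ₁) Γ) → All G (map (subFm τ₂) Γ)
All-subst-atomic []      []                 h []       = []
All-subst-atomic (_ ∷ Γ) ((p , refl) ∷ ats) h (x ∷ xs) =
  h (here refl) x ∷ All-subst-atomic Γ ats (λ m → h (there m)) xs

Vars-subst-atomic : ∀ τ Γ → All IsAtom Γ →
                    ∀ {q} → Vars (map (subFm τ) Γ) q → Σ Atom λ p → at p ∈ Γ × Var (τ p) q
Vars-subst-atomic τ Γ ats (_ , m , o)
  with γ , γ∈Γ , refl ← ∈-map⁻ (subFm τ) m
  with p , refl ← All.lookup ats γ∈Γ
  = p , γ∈Γ , o

module Interpolation (E : RuleSet) (gen : (k : Idx E) → IsGenCut (rule E k)) (s : Seq) where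

  I : AtomSet
  I = SeqVars s

  open Structural E (_≡ s)
  open Completeness E (_≡ s)
  open Inversion E (_≡ s) public
  open Erasure I (SeqVars? s)

  Interpolated : Seq → Set₁
  Interpolated t = ∀ A B → Refutes A B t → Residue {A} {B} I [] []

  restrict : ∀ {A : AtomSet} {L} → All (A ∪ ∁ I) L → All I L → All A L
  restrict []             []       = []
  restrict (inj₁ a  ∷ as) (_ ∷ is) = a ∷ restrict as is
  restrict (inj₂ ¬i ∷ _)  (i ∷ _)  = ⊥-elim (¬i i)

  module Instance (k : Idx E) (σ : Atom → Fm) where

    r : StructRule
    r = rule E k

    data Role (p : Atom) : Set where
      internal  : ¬ OccSeq p (concl r) → Role p
      leftSide  : OnlyLeft p r → Role p
      rightSide : OnlyRight p r → Role p

    role : ∀ p → Role p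
    role p with SeqVars? (concl r) p
    ... | no ∉concl = internal ∉concl
    ... | yes ∈concl with gen k p (inj₁ ∈concl)
    ...   | inj₁ cut          = ⊥-elim (cut ∈concl)
    ...   | inj₂ (inj₁ onlyL) = leftSide onlyL
    ...   | inj₂ (inj₂ onlyR) = rightSide onlyR

    adjust : ∀ p → Role p → Fm
    adjust p (internal _)  = σ p
    adjust p (leftSide _)  = eraseL (σ p)
    adjust p (rightSide _) = eraseR (σ p)

    σ′ : Atom → Fm
    σ′ p = adjust p (role p)

    module _ {A B : AtomSet} where

      Holds-prem : ∀ {i p} → at p ∈ lhs (prem r i) → ∀ ρ →
                   Holds A B (adjust p ρ) → Holds (A ∪ ∁ I) (B ∪ ∁ I) (σ p)
      Holds-prem {p = p} _  (internal _)            = Holds-mono inj₁ inj₁ (σ p)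
      Holds-prem {p = p} _  (leftSide _)            = eraseL-Holds (σ p)
      Holds-prem {i}     p∈ (rightSide (_ , ∉lhs)) = ⊥-elim (∉lhs i (_ , p∈ , o-at))

      Fails-prem : ∀ {i p} → at p ∈ rhs (prem r i) → ∀ ρ →
                   Fails A B (adjust p ρ) → Fails (A ∪ ∁ I) (B ∪ ∁ I) (σ p)
      Fails-prem {p = p} _  (internal _)            = Fails-mono inj₁ inj₁ (σ p)
      Fails-prem {i}     p∈ (leftSide (_ , ∉rhs))  = ⊥-elim (∉rhs i (_ , p∈ , o-at))
      Fails-prem {p = p} _  (rightSide _)           = eraseR-Fails (σ p)

      Holds-concl : ∀ {p} → at p ∈ lhs (concl r) → ∀ ρ → Holds A B (σ p) → Holds A B (adjust p ρ)
      Holds-concl     _  (internal _)            h = h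
      Holds-concl {p} _  (leftSide _)            h = Holds-eraseL (σ p) h
      Holds-concl     p∈ (rightSide (∉lhs , _)) _ = ⊥-elim (∉lhs (_ , p∈ , o-at))

      Fails-concl : ∀ {p} → at p ∈ rhs (concl r) → ∀ ρ → Fails A B (σ p) → Fails A B (adjust p ρ)
      Fails-concl     _  (internal _)            f = f
      Fails-concl     p∈ (leftSide (∉rhs , _))  _ = ⊥-elim (∉rhs (_ , p∈ , o-at))
      Fails-concl {p} _  (rightSide _)           f = Fails-eraseR (σ p) f

      refutes-prem : ∀ i → Refutes A B (subSeq σ′ (prem r i)) →
                     Refutes (A ∪ ∁ I) (B ∪ ∁ I) (subSeq σ (prem r i))
      refutes-prem i (hs , fs) =
        All-subst-atomic (lhs (prem r i)) (proj₁ (premAtomic r i))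
          (λ {p} p∈ → Holds-prem p∈ (role p)) hs ,
        All-subst-atomic (rhs (prem r i)) (proj₂ (premAtomic r i))
          (λ {p} p∈ → Fails-prem p∈ (role p)) fs

      refutes-concl : Refutes A B (subSeq σ (concl r)) → Refutes A B (subSeq σ′ (concl r))
      refutes-concl (hs , fs) =
        All-subst-atomic (lhs (concl r)) (proj₁ (conclAtomic r))
          (λ {p} p∈ → Holds-concl p∈ (role p)) hs ,
        All-subst-atomic (rhs (concl r)) (proj₂ (conclAtomic r))
          (λ {p} p∈ → Fails-concl p∈ (role p)) fs

    Var-adjust : ∀ {p} → OccSeq p (concl r) → ∀ ρ → Var (adjust p ρ) ⊆ I
    Var-adjust     ∈concl (internal ∉concl) _ = ⊥-elim (∉concl ∈concl)
    Var-adjust {p} _      (leftSide _)        = Var-eraseL (σ p)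
    Var-adjust {p} _      (rightSide _)       = Var-eraseR (σ p)

    SeqVars-concl : SeqVars (subSeq σ′ (concl r)) ⊆ I
    SeqVars-concl (inj₁ o)
      with p , p∈ , o′ ← Vars-subst-atomic σ′ (lhs (concl r)) (proj₁ (conclAtomic r)) o
      = Var-adjust (inj₁ (_ , p∈ , o-at)) (role p) o′
    SeqVars-concl (inj₂ o)
      with p , p∈ , o′ ← Vars-subst-atomic σ′ (rhs (concl r)) (proj₂ (conclAtomic r)) o
      = Var-adjust (inj₂ (_ , p∈ , o-at)) (role p) o′

  interpolated : ∀ {t} → Der E (_≡ s) t → Interpolated t
  interpolated (hyp refl)    A B ref                    = residueSeq (hyp refl) ref
  interpolated (perm p q d)  A B ref                    =
    interpolated d A B (Refutes-resp-↭ (↭-sym p) (↭-sym q) ref)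
  interpolated (∧R d₁ d₂)    A B (hs , inj₁ a ∷ fs)     = interpolated d₁ A B (hs , a ∷ fs)
  interpolated (∧R d₁ d₂)    A B (hs , inj₂ b ∷ fs)     = interpolated d₂ A B (hs , b ∷ fs)
  interpolated (∧L d)        A B ((a , b) ∷ hs , fs)    = interpolated d A B (a ∷ b ∷ hs , fs)
  interpolated (∨L d₁ d₂)    A B (inj₁ a ∷ hs , fs)     = interpolated d₁ A B (a ∷ hs , fs)
  interpolated (∨L d₁ d₂)    A B (inj₂ b ∷ hs , fs)     = interpolated d₂ A B (b ∷ hs , fs)
  interpolated (∨R d)        A B (hs , (a , b) ∷ fs)    = interpolated d A B (hs , a ∷ b ∷ fs)
  interpolated (-R d)        A B (hs , a ∷ fs)          = interpolated d A B (a ∷ hs , fs)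
  interpolated (-L d)        A B (a ∷ hs , fs)          = interpolated d A B (hs , a ∷ fs)
  interpolated ⊤ax           A B (_ , () ∷ _)
  interpolated ⊥ax           A B (() ∷ _ , _)
  interpolated (∧R-e₁ d)     A B (hs , a ∷ fs)          = interpolated d A B (hs , inj₁ a ∷ fs)
  interpolated (∧R-e₂ d)     A B (hs , b ∷ fs)          = interpolated d A B (hs , inj₂ b ∷ fs)
  interpolated (∧L-e d)      A B (a ∷ b ∷ hs , fs)      = interpolated d A B ((a , b) ∷ hs , fs)
  interpolated (∨L-e₁ d)     A B (a ∷ hs , fs)          = interpolated d A B (inj₁ a ∷ hs , fs)
  interpolated (∨L-e₂ d)     A B (b ∷ hs , fs)          = interpolated d A B (inj₂ b ∷ hs , fs)
  interpolated (∨R-e d)      A B (hs , a ∷ b ∷ fs)      = interpolated d A B (hs , (a , b) ∷ fs)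
  interpolated (-R-e d)      A B (a ∷ hs , fs)          = interpolated d A B (hs , a ∷ fs)
  interpolated (-L-e d)      A B (hs , a ∷ fs)          = interpolated d A B (a ∷ hs , fs)
  interpolated (⊤L-e d)      A B (hs , fs)              = interpolated d A B (tt ∷ hs , fs)
  interpolated (⊥R-e d)      A B (hs , fs)              = interpolated d A B (hs , tt ∷ fs)
  interpolated (wL d)        A B (_ ∷ hs , fs)          = interpolated d A B (hs , fs)
  interpolated (wR d)        A B (hs , _ ∷ fs)          = interpolated d A B (hs , fs)
  interpolated (cL d)        A B (a ∷ hs , fs)          = interpolated d A B (a ∷ a ∷ hs , fs)
  interpolated (cR d)        A B (hs , b ∷ fs)          = interpolated d A B (hs , b ∷ b ∷ fs)
  interpolated (str k σ ⊢prem) A B ref =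
    residue-mono SeqVars-concl
      (residueSeq (str k σ′ (λ i → covered⇒derivable (covered i))) (refutes-concl ref))
    where
    open Instance k σ
    covered : ∀ i → Covered (subSeq σ′ (prem r i))
    covered i A₀ B₀ ref₀
      with residue L R (as , bs) (iₗ , iᵣ) d ← interpolated (⊢prem i) _ _ (refutes-prem i ref₀)
      = (L , R) , (restrict as iₗ , restrict bs iᵣ) , dropNilʳ d

_⊗_ : List Clause → List Clause → List Clause
_⊗_ = cartesianProductWith _⊕_

module _ {A B : AtomSet} where

  Any-⊗⁺ : ∀ {xs ys} → Any (AllAtoms A B) xs → Any (AllAtoms A B) ys → Any (AllAtoms A B) (xs ⊗ ys)
  Any-⊗⁺ = Any.cartesianProductWith⁺ _⊕_ (λ {c} {d} → AllAtoms-⊕⁺ c d)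

  Any-⊗⁻ : ∀ xs ys → Any (AllAtoms A B) (xs ⊗ ys) → Any (AllAtoms A B) xs × Any (AllAtoms A B) ys
  Any-⊗⁻ = Any.cartesianProductWith⁻ _⊕_ (λ {c} {d} → AllAtoms-⊕⁻ c d)

  All-⊗⁺ : ∀ {xs ys} → All (AllAtoms A B) xs → All (AllAtoms A B) ys → All (AllAtoms A B) (xs ⊗ ys)
  All-⊗⁺ {xs} {ys} as bs =
    All.cartesianProductWith⁺ (≡.setoid _) (≡.setoid _) _⊕_ xs ys
      (λ {c} {d} c∈ d∈ → AllAtoms-⊕⁺ c d (All.lookup as c∈) (All.lookup bs d∈))

-- Conjunctive normal forms: t is equivalent to the conjunction of the atomic sequents in
-- clauses t, and a formula on the left (right) to that of clausesL (clausesR).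
clausesL clausesR : Fm → List Clause
clausesL (at p)   = (p ∷ [] , []) ∷ []
clausesL (φ ∧′ ψ) = clausesL φ ⊗ clausesL ψ
clausesL (φ ∨′ ψ) = clausesL φ ++ clausesL ψ
clausesL (-′ φ)   = clausesR φ
clausesL ⊤′       = ([] , []) ∷ []
clausesL ⊥′       = []
clausesR (at p)   = ([] , p ∷ []) ∷ []
clausesR (φ ∧′ ψ) = clausesR φ ++ clausesR ψ
clausesR (φ ∨′ ψ) = clausesR φ ⊗ clausesR ψ
clausesR (-′ φ)   = clausesL φ
clausesR ⊤′       = []
clausesR ⊥′       = ([] , []) ∷ []

clausesAll : (Fm → List Clause) → List Fm → List Clause
clausesAll f []      = ([] , []) ∷ []
clausesAll f (γ ∷ Γ) = f γ ⊗ clausesAll f Γ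

clauses : Seq → List Clause
clauses t = clausesAll clausesL (lhs t) ⊗ clausesAll clausesR (rhs t)

module _ {A B : AtomSet} where

  Holds⇒clausesL : ∀ φ → Holds A B φ → Any (AllAtoms A B) (clausesL φ)
  Fails⇒clausesR : ∀ φ → Fails A B φ → Any (AllAtoms A B) (clausesR φ)
  Holds⇒clausesL (at p)   a        = here (a ∷ [] , [])
  Holds⇒clausesL (φ ∧′ ψ) (a , b)  = Any-⊗⁺ (Holds⇒clausesL φ a) (Holds⇒clausesL ψ b)
  Holds⇒clausesL (φ ∨′ ψ) (inj₁ a) = Any.++⁺ˡ (Holds⇒clausesL φ a)
  Holds⇒clausesL (φ ∨′ ψ) (inj₂ b) = Any.++⁺ʳ (clausesL φ) (Holds⇒clausesL ψ b)
  Holds⇒clausesL (-′ φ)   a        = Fails⇒clausesR φ a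
  Holds⇒clausesL ⊤′       _        = here ([] , [])
  Fails⇒clausesR (at p)   b        = here ([] , b ∷ [])
  Fails⇒clausesR (φ ∧′ ψ) (inj₁ a) = Any.++⁺ˡ (Fails⇒clausesR φ a)
  Fails⇒clausesR (φ ∧′ ψ) (inj₂ b) = Any.++⁺ʳ (clausesR φ) (Fails⇒clausesR ψ b)
  Fails⇒clausesR (φ ∨′ ψ) (a , b)  = Any-⊗⁺ (Fails⇒clausesR φ a) (Fails⇒clausesR ψ b)
  Fails⇒clausesR (-′ φ)   a        = Holds⇒clausesL φ a
  Fails⇒clausesR ⊥′       _        = here ([] , [])

  clausesL⇒Holds : ∀ φ → Any (AllAtoms A B) (clausesL φ) → Holds A B φ
  clausesR⇒Fails : ∀ φ → Any (AllAtoms A B) (clausesR φ) → Fails A B φ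
  clausesL⇒Holds (at p)   (here (a ∷ [] , [])) = a
  clausesL⇒Holds (φ ∧′ ψ) w =
    Product.map (clausesL⇒Holds φ) (clausesL⇒Holds ψ) (Any-⊗⁻ (clausesL φ) (clausesL ψ) w)
  clausesL⇒Holds (φ ∨′ ψ) w =
    Sum.map (clausesL⇒Holds φ) (clausesL⇒Holds ψ) (Any.++⁻ (clausesL φ) w)
  clausesL⇒Holds (-′ φ)   w = clausesR⇒Fails φ w
  clausesL⇒Holds ⊤′       _ = tt
  clausesR⇒Fails (at p)   (here ([] , b ∷ [])) = b
  clausesR⇒Fails (φ ∧′ ψ) w =
    Sum.map (clausesR⇒Fails φ) (clausesR⇒Fails ψ) (Any.++⁻ (clausesR φ) w)
  clausesR⇒Fails (φ ∨′ ψ) w =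
    Product.map (clausesR⇒Fails φ) (clausesR⇒Fails ψ) (Any-⊗⁻ (clausesR φ) (clausesR ψ) w)
  clausesR⇒Fails (-′ φ)   w = clausesL⇒Holds φ w
  clausesR⇒Fails ⊥′       _ = tt

  All⇒clausesAll : ∀ {F : Fm → Set} f → (∀ φ → F φ → Any (AllAtoms A B) (f φ)) →
                   ∀ {Γ} → All F Γ → Any (AllAtoms A B) (clausesAll f Γ)
  All⇒clausesAll f h []       = here ([] , [])
  All⇒clausesAll f h (x ∷ xs) = Any-⊗⁺ (h _ x) (All⇒clausesAll f h xs)

  clausesAll⇒All : ∀ {F : Fm → Set} f → (∀ φ → Any (AllAtoms A B) (f φ) → F φ) →
                   ∀ Γ → Any (AllAtoms A B) (clausesAll f Γ) → All F Γ
  clausesAll⇒All f h []      _ = []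
  clausesAll⇒All f h (γ ∷ Γ) w =
    let x , xs = Any-⊗⁻ (f γ) (clausesAll f Γ) w in h γ x ∷ clausesAll⇒All f h Γ xs

  Refutes⇒clauses : ∀ {t} → Refutes A B t → Any (AllAtoms A B) (clauses t)
  Refutes⇒clauses (hs , fs) =
    Any-⊗⁺ (All⇒clausesAll clausesL Holds⇒clausesL hs) (All⇒clausesAll clausesR Fails⇒clausesR fs)

  clauses⇒Refutes : ∀ t → Any (AllAtoms A B) (clauses t) → Refutes A B t
  clauses⇒Refutes t w =
    let l , r = Any-⊗⁻ (clausesAll clausesL (lhs t)) (clausesAll clausesR (rhs t)) w
    in clausesAll⇒All clausesL clausesL⇒Holds (lhs t) l , clausesAll⇒All clausesR clausesR⇒Fails (rhs t) r

clausesL-Var : ∀ φ → All (Within (Var φ)) (clausesL φ)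
clausesR-Var : ∀ φ → All (Within (Var φ)) (clausesR φ)
clausesL-Var (at p)   = (o-at ∷ [] , []) ∷ []
clausesL-Var (φ ∧′ ψ) = All-⊗⁺ (All-Within-mono o-∧l (clausesL-Var φ)) (All-Within-mono o-∧r (clausesL-Var ψ))
clausesL-Var (φ ∨′ ψ) = ++⁺ (All-Within-mono o-∨l (clausesL-Var φ)) (All-Within-mono o-∨r (clausesL-Var ψ))
clausesL-Var (-′ φ)   = All-Within-mono o-neg (clausesR-Var φ)
clausesL-Var ⊤′       = ([] , []) ∷ []
clausesL-Var ⊥′       = []
clausesR-Var (at p)   = ([] , o-at ∷ []) ∷ []
clausesR-Var (φ ∧′ ψ) = ++⁺ (All-Within-mono o-∧l (clausesR-Var φ)) (All-Within-mono o-∧r (clausesR-Var ψ))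
clausesR-Var (φ ∨′ ψ) = All-⊗⁺ (All-Within-mono o-∨l (clausesR-Var φ)) (All-Within-mono o-∨r (clausesR-Var ψ))
clausesR-Var (-′ φ)   = All-Within-mono o-neg (clausesL-Var φ)
clausesR-Var ⊤′       = []
clausesR-Var ⊥′       = ([] , []) ∷ []

clausesAll-Vars : ∀ f → (∀ φ → All (Within (Var φ)) (f φ)) →
                  ∀ Γ → All (Within (Vars Γ)) (clausesAll f Γ)
clausesAll-Vars f h []      = ([] , []) ∷ []
clausesAll-Vars f h (γ ∷ Γ) =
  All-⊗⁺ (All-Within-mono (Var⊆Vars (here refl)) (h γ)) (All-Within-mono Vars-∷ (clausesAll-Vars f h Γ))

clauses-SeqVars : ∀ t → All (Within (SeqVars t)) (clauses t)
clauses-SeqVars t =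
  All-⊗⁺ (All-Within-mono inj₁ (clausesAll-Vars clausesL clausesL-Var (lhs t)))
         (All-Within-mono inj₂ (clausesAll-Vars clausesR clausesR-Var (rhs t)))

⋁ : List Atom → Fm
⋁ []      = ⊥′
⋁ (r ∷ R) = at r ∨′ ⋁ R

⋁¬ : List Atom → Fm → Fm
⋁¬ []      ψ = ψ
⋁¬ (l ∷ L) ψ = (-′ at l) ∨′ ⋁¬ L ψ

clauseFm : Clause → Fm
clauseFm (L , R) = ⋁¬ L (⋁ R)

⋀ : List Clause → Fm
⋀ []       = ⊤′
⋀ (d ∷ ds) = clauseFm d ∧′ ⋀ ds

Var-⋁ : ∀ R → Var (⋁ R) ⊆ (_∈ R)
Var-⋁ (r ∷ R) (o-∨l o-at) = here refl
Var-⋁ (r ∷ R) (o-∨r o)    = there (Var-⋁ R o)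

Var-clauseFm : ∀ {P} c → Within P c → Var (clauseFm c) ⊆ P
Var-clauseFm (L , R) (inL , inR) = go L inL
  where
  go : ∀ L → All _ L → Var (⋁¬ L (⋁ R)) ⊆ _
  go []      _         o                  = All.lookup inR (Var-⋁ R o)
  go (l ∷ L) (i ∷ _)   (o-∨l (o-neg o-at)) = i
  go (l ∷ L) (_ ∷ inL) (o-∨r o)          = go L inL o

Var-⋀ : ∀ {P} ds → All (Within P) ds → Var (⋀ ds) ⊆ P
Var-⋀ (d ∷ ds) (w ∷ _)  (o-∧l o) = Var-clauseFm d w o
Var-⋀ (d ∷ ds) (_ ∷ ws) (o-∧r o) = Var-⋀ ds ws o

module Packing (E : RuleSet) (S : Seq → Set) where
  open Structural E S

  pack⋁ : ∀ R {Γ Δ} → D (Γ ▷ atoms R ++ Δ) → D (Γ ▷ ⋁ R ∷ Δ)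
  pack⋁ []      d = wR d
  pack⋁ (r ∷ R) {Δ = Δ} d =
    ∨R (permR (swap (⋁ R) (at r) ↭-refl) (pack⋁ R (permR (↭-sym (shift (at r) (atoms R) Δ)) d)))

  pack⋁¬ : ∀ L {Γ ψ Δ} → D (atoms L ++ Γ ▷ ψ ∷ Δ) → D (Γ ▷ ⋁¬ L ψ ∷ Δ)
  pack⋁¬ []      d = d
  pack⋁¬ (l ∷ L) {Γ} d = ∨R (-R (pack⋁¬ L (permL (↭-sym (shift (at l) (atoms L) Γ)) d)))

  packClause : ∀ c → D (clauseSeq c) → D ([] ▷ clauseFm c ∷ [])
  packClause (L , R) d = pack⋁¬ L (pack⋁ R (addNilʳ d))

  pack⋀ : ∀ {ds} → All (λ d → D (clauseSeq d)) ds → D ([] ▷ ⋀ ds ∷ [])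
  pack⋀ []       = ⊤ax
  pack⋀ (d ∷ ds) = ∧R (packClause _ d) (pack⋀ ds)

  unpack⋁ : ∀ R {Γ Δ} → D (Γ ▷ ⋁ R ∷ Δ) → D (Γ ▷ atoms R ++ Δ)
  unpack⋁ []      d = ⊥R-e d
  unpack⋁ (r ∷ R) {Δ = Δ} d =
    permR (shift (at r) (atoms R) Δ) (unpack⋁ R (permR (swap (at r) (⋁ R) ↭-refl) (∨R-e d)))

  unpack⋁¬ : ∀ L {Γ ψ Δ} → D (Γ ▷ ⋁¬ L ψ ∷ Δ) → D (atoms L ++ Γ ▷ ψ ∷ Δ)
  unpack⋁¬ []      d = d
  unpack⋁¬ (l ∷ L) {Γ} d = permL (shift (at l) (atoms L) Γ) (unpack⋁¬ L (-R-e (∨R-e d)))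

  unpackClause : ∀ c → D ([] ▷ clauseFm c ∷ []) → D (clauseSeq c)
  unpackClause (L , R) d = dropNilʳ (unpack⋁ R (unpack⋁¬ L d))

  unpack⋀ : ∀ {ds d} → d ∈ ds → D ([] ▷ ⋀ ds ∷ []) → D ([] ▷ clauseFm d ∷ [])
  unpack⋀ (here refl) x = ∧R-e₁ x
  unpack⋀ (there d∈)  x = unpack⋀ d∈ (∧R-e₂ x)

module Interpolant (E : RuleSet) (gen : (k : Idx E) → IsGenCut (rule E k))
                   {s t : Seq} (s⊢t : s ⊢[ E ] t) where
  open Interpolation E gen s using (Residue; left; right; refuted; within; derivable; interpolated)

  residueOf : ∀ {c} → c ∈ clauses t → Residue {_∈ proj₁ c} {_∈ proj₂ c} (SeqVars s) [] []
  residueOf {c} c∈ = interpolated s⊢t _ _ (clauses⇒Refutes t (lose c∈ (⊆ᶜ-refl c)))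

  chosen : ∀ {c} → c ∈ clauses t → Clause
  chosen c∈ = left (residueOf c∈) , right (residueOf c∈)

  chosen⊆ᶜ : ∀ {c} (c∈ : c ∈ clauses t) → chosen c∈ ⊆ᶜ c
  chosen⊆ᶜ c∈ = refuted (residueOf c∈)

  interpolant : Seq
  interpolant = [] ▷ ⋀ (mapWith∈ (clauses t) chosen) ∷ []

  s⊢interpolant : s ⊢[ E ] interpolant
  s⊢interpolant = pack⋀ (All-mapWith∈ (clauses t) chosen λ c∈ → dropNilʳ (derivable (residueOf c∈)))
    where
    open Structural E (_≡ s)
    open Packing E (_≡ s)

  interpolant⊢t : interpolant ⊢[ noRules ] t
  interpolant⊢t = covered⇒derivable cover
    where
    open Completeness noRules (_≡ interpolant)
    open Packing noRules (_≡ interpolant)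
    cover : Covered t
    cover A B ref with c , c∈ , ab ← find (Refutes⇒clauses ref) =
      chosen c∈ , AllAtoms-⊆ᶜ (chosen⊆ᶜ c∈) ab ,
      unpackClause (chosen c∈) (unpack⋀ (mapWith∈⁺ chosen (c , c∈ , refl)) (hyp refl))

  interpolant-vars : SeqVars interpolant ⊆ SeqVars s ∩ SeqVars t
  interpolant-vars (inj₂ (_ , here refl , o)) = Var-⋀ _ chosen-within o
    where
    chosen-within : All (Within (SeqVars s ∩ SeqVars t)) (mapWith∈ (clauses t) chosen)
    chosen-within = All-mapWith∈ (clauses t) chosen λ c∈ →
      Within-∩ (within (residueOf c∈)) (AllAtoms-⊆ᶜ (chosen⊆ᶜ c∈) (All.lookup (clauses-SeqVars t) c∈))

theorem5p11 : (E : RuleSet) → ((k : Idx E) → IsGenCut (rule E k)) →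
    (s t : Seq) → s ⊢[ E ] t →
    Σ Seq (λ u → (s ⊢[ E ] u) × (u ⊢[ noRules ] t) ×
    ((p : Atom) → OccSeq p u → OccSeq p s × OccSeq p t))
theorem5p11 E gen s t s⊢t = interpolant , s⊢interpolant , interpolant⊢t , λ _ → interpolant-vars
  where open Interpolant E gen s⊢t
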